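{- Let $G=(V,E)$ be a simple undirected graph, $t\ge 0$ an integer and $S\subseteq V$. Then $S$ is a $t$-hereditary 2-club in $G$ if and only if every pair of nonadjacent vertices of $S$ has at least $t+1$ common neighbors in $G[S]$.
   Context: For $S\subseteq V$, $G[S]$ denotes the subgraph induced by $S$. A vertex set $S$ is a 2-club in $G$ if $G[S]$ has diameter at most two, i.e. every two vertices of $S$ are adjacent or have a common neighbor in $G[S]$. A vertex set $S\subseteq V$ is a $t$-hereditary 2-club in $G$ if $G[S\setminus U]$ is a 2-club for all $U\subset S$ with $|U|\le t$. -}

module Defs where

open import Data.Nat using (ℕ; suc; _≤_)
open import Data.Fin using (Fin)
open import Data.Fin.Subset using (Subset; _∈_; _⊂_; _─_; ∣_∣)
open import Data.Bool using (_∧_)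
open import Data.Vec using (tabulate; lookup)
open import Data.Product using (Σ; _×_)
open import Data.Sum using (_⊎_)
open import Relation.Nullary using (¬_; Dec)
open import Relation.Nullary.Decidable using (⌊_⌋)
open import Relation.Binary.PropositionalEquality using (_≢_)

record SimpleGraph (n : ℕ) : Set₁ where
  field
    Adj     : Fin n → Fin n → Set
    sym     : ∀ {u v} → Adj u v → Adj v u
    irrefl  : ∀ {u} → ¬ Adj u u
    adj?    : ∀ u v → Dec (Adj u v)

module _ {n : ℕ} (G : SimpleGraph n) where
  open SimpleGraph G

  Is2Club : Subset n → Set
  Is2Club S = ∀ u v → u ∈ S → v ∈ S → u ≢ v →
              Adj u v ⊎ Σ (Fin n) (λ w → w ∈ S × Adj u w × Adj w v)

  IsHereditary2Club : ℕ → Subset n → Set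
  IsHereditary2Club t S = ∀ U → U ⊂ S → ∣ U ∣ ≤ t → Is2Club (S ─ U)

  commonNbrs : Subset n → Fin n → Fin n → Subset n
  commonNbrs S u v = tabulate λ w → lookup S w ∧ ⌊ adj? u w ⌋ ∧ ⌊ adj? v w ⌋

module Submission where

-- Write C(u,v) for the set of common neighbours of u and v inside S.  For
-- nonadjacent u, v ∈ S and a set U, the vertices u and v are at distance at
-- most two in G[S ∖ U] exactly when some member of C(u,v) avoids U.
--   (⇐) If |U| ≤ t < |C(u,v)|, a counting argument (a set strictly larger
--       than U has an element outside U) produces such a member.
--   (⇒) If |C(u,v)| ≤ t, delete U = C(u,v) itself: it is a proper subset of S
--       (u ∈ S is not its own neighbour), yet in G[S ∖ C(u,v)] the vertices u
--       and v are neither adjacent nor joined by a common neighbour.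

open import Defs
open import Data.Nat using (ℕ; suc; _≤_; _<_)
open import Data.Nat.Properties using (_≤?_; ≰⇒>; ≤-<-trans; <⇒≱)
open import Data.Fin using (Fin)
open import Data.Fin.Subset using (Subset; _∈_; _∉_; ∣_∣; _─_; _⊆_; _⊂_; inside; outside)
open import Data.Fin.Subset.Properties
  using (_∈?_; p⊆q⇒∣p∣≤∣q∣; x∈p∧x∉q⇒x∈p─q; p─q⊆p)
open import Data.Fin.Properties using (any?)
open import Data.Bool using (Bool; T)
open import Data.Bool.Properties using (T-≡; T-∧)
open import Data.Vec using (_∷_; lookup; tabulate; there)
open import Data.Vec.Properties using (lookup∘tabulate; []=⇒lookup; lookup⇒[]=)
open import Data.Product using (Σ; ∃; _×_; _,_; proj₁; proj₂)
open import Data.Product.Function.NonDependent.Propositional using (_×-⇔_)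
open import Data.Sum using (_⊎_; inj₁; inj₂)
open import Function using (_∘_)
open import Function.Bundles using (_⇔_; mk⇔; Equivalence)
open import Function.Properties.Equivalence using () renaming (trans to ⇔-trans; sym to ⇔-sym)
open import Relation.Nullary using (¬_; Dec; yes; no; contradiction)
open import Relation.Nullary.Decidable using (_×-dec_; ¬?; toWitness; fromWitness; ⌊_⌋; decidable-stable)
open import Relation.Binary.PropositionalEquality using (_≢_; subst)

open Equivalence using (to; from)

x∈p─q⇒x∉q : ∀ {n} {x : Fin n} (p q : Subset n) → x ∈ p ─ q → x ∉ q
x∈p─q⇒x∉q (_ ∷ p) (outside ∷ q) (there x∈p─q) (there x∈q) = x∈p─q⇒x∉q p q x∈p─q x∈q
x∈p─q⇒x∉q (_ ∷ p) (inside  ∷ q) (there x∈p─q) (there x∈q) = x∈p─q⇒x∉q p q x∈p─q x∈q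

-- Counting: a subset strictly larger than q has an element outside q.
-- Otherwise p ⊆ q (membership in q is decidable), so |p| ≤ |q|.
∣q∣<∣p∣⇒∃x∈p∖q : ∀ {n} (p q : Subset n) → ∣ q ∣ < ∣ p ∣ → ∃ λ x → x ∈ p × x ∉ q
∣q∣<∣p∣⇒∃x∈p∖q p q ∣q∣<∣p∣ with any? (λ x → (x ∈? p) ×-dec ¬? (x ∈? q))
... | yes witness  = witness
... | no noWitness = contradiction (p⊆q⇒∣p∣≤∣q∣ p⊆q) (<⇒≱ ∣q∣<∣p∣)
  where
  p⊆q : p ⊆ q
  p⊆q {x} x∈p = decidable-stable (x ∈? q) (λ x∉q → noWitness (x , x∈p , x∉q))

∈⇔T-lookup : ∀ {n} (p : Subset n) (x : Fin n) → x ∈ p ⇔ T (lookup p x)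
∈⇔T-lookup p x = mk⇔ (from T-≡ ∘ []=⇒lookup) (lookup⇒[]= x p ∘ to T-≡)

∈-tabulate : ∀ {n} (f : Fin n → Bool) (x : Fin n) → x ∈ tabulate f ⇔ T (f x)
∈-tabulate f x = subst (λ b → x ∈ tabulate f ⇔ T b) (lookup∘tabulate f x) (∈⇔T-lookup (tabulate f) x)

module _ {n : ℕ} (G : SimpleGraph n) where
  open SimpleGraph G

  Within2 : Subset n → Fin n → Fin n → Set
  Within2 S u v = Adj u v ⊎ Σ (Fin n) (λ w → w ∈ S × Adj u w × Adj w v)

  ∈-commonNbrs : ∀ S u v w → w ∈ commonNbrs G S u v ⇔ (w ∈ S × Adj u w × Adj v w)
  ∈-commonNbrs S u v w =
    ⇔-trans (∈-tabulate _ w)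
      (⇔-trans T-∧ (⇔-sym (∈⇔T-lookup S w) ×-⇔ ⇔-trans T-∧ (decided (adj? u w) ×-⇔ decided (adj? v w))))
    where
    decided : ∀ {A : Set} (a? : Dec A) → T ⌊ a? ⌋ ⇔ A
    decided a? = mk⇔ (toWitness {a? = a?}) (fromWitness {a? = a?})

  -- C(u,v) is a proper subset of S when u ∈ S, as u is not its own neighbour.
  commonNbrs⊂S : ∀ S u v → u ∈ S → commonNbrs G S u v ⊂ S
  commonNbrs⊂S S u v u∈S =
    proj₁ ∘ to (∈-commonNbrs S u v _) , u , u∈S , irrefl ∘ proj₁ ∘ proj₂ ∘ to (∈-commonNbrs S u v u)

  commonNbr∉U⇒Within2 : ∀ S U u v w → w ∈ commonNbrs G S u v → w ∉ U → Within2 (S ─ U) u v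
  commonNbr∉U⇒Within2 S U u v w w∈C w∉U with to (∈-commonNbrs S u v w) w∈C
  ... | w∈S , u~w , v~w = inj₂ (w , x∈p∧x∉q⇒x∈p─q w∈S w∉U , u~w , sym v~w)

  ¬Within2-without-commonNbrs : ∀ S u v → ¬ Adj u v → ¬ Within2 (S ─ commonNbrs G S u v) u v
  ¬Within2-without-commonNbrs S u v u≁v (inj₁ u~v) = u≁v u~v
  ¬Within2-without-commonNbrs S u v u≁v (inj₂ (w , w∈S─C , u~w , w~v)) =
    x∈p─q⇒x∉q S C w∈S─C (from (∈-commonNbrs S u v w) (p─q⊆p S C w∈S─C , u~w , sym w~v))
    where C = commonNbrs G S u v

  ManyCommonNbrs : ℕ → Subset n → Set
  ManyCommonNbrs t S = ∀ u v → u ∈ S → v ∈ S → u ≢ v → ¬ Adj u v → suc t ≤ ∣ commonNbrs G S u v ∣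

  -- (⇒) If |C(u,v)| ≤ t, deleting C(u,v) would violate the 2-club property.
  hereditary⇒many : ∀ t S → IsHereditary2Club G t S → ManyCommonNbrs t S
  hereditary⇒many t S hereditary u v u∈S v∈S u≢v u≁v with ∣ commonNbrs G S u v ∣ ≤? t
  ... | no ∣C∣≰t = ≰⇒> ∣C∣≰t
  ... | yes ∣C∣≤t = contradiction
          (hereditary C (commonNbrs⊂S S u v u∈S) ∣C∣≤t u v (x∈p∧x∉q⇒x∈p─q u∈S u∉C) (x∈p∧x∉q⇒x∈p─q v∈S v∉C) u≢v)
          (¬Within2-without-commonNbrs S u v u≁v)
    where
    C = commonNbrs G S u v
    u∉C : u ∉ C
    u∉C = irrefl ∘ proj₁ ∘ proj₂ ∘ to (∈-commonNbrs S u v u)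
    v∉C : v ∉ C
    v∉C = irrefl ∘ proj₂ ∘ proj₂ ∘ to (∈-commonNbrs S u v v)

  -- (⇐) Deleting |U| ≤ t < |C(u,v)| vertices leaves some common neighbour.
  many⇒hereditary : ∀ t S → ManyCommonNbrs t S → IsHereditary2Club G t S
  many⇒hereditary t S many U _ ∣U∣≤t u v u∈S─U v∈S─U u≢v with adj? u v
  ... | yes u~v = inj₁ u~v
  ... | no u≁v with ∣q∣<∣p∣⇒∃x∈p∖q (commonNbrs G S u v) U
                     (≤-<-trans ∣U∣≤t (many u v (p─q⊆p S U u∈S─U) (p─q⊆p S U v∈S─U) u≢v u≁v))
  ... | w , w∈C , w∉U = commonNbr∉U⇒Within2 S U u v w w∈C w∉U

lemma1 : ∀ {n : ℕ} (G : SimpleGraph n) (t : ℕ) (S : Subset n) →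
    IsHereditary2Club G t S ⇔
    (∀ u v → u ∈ S → v ∈ S → u ≢ v → ¬ SimpleGraph.Adj G u v →
      suc t ≤ ∣ commonNbrs G S u v ∣)
lemma1 G t S = mk⇔ (hereditary⇒many G t S) (many⇒hereditary G t S)
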